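{- Let $\Delta_2>\Delta_1\ge1$ be integers, let $\mathcal G$ be a $(\Delta_1,\Delta_2)$-cluster temporal graph and let $S\subseteq V(\mathcal G)$. Then $\mathcal G[S]$ is also a $(\Delta_1,\Delta_2)$-cluster temporal graph.
   Context: A temporal graph $\mathcal G=(G,\mathcal T)$ consists of a finite static undirected graph $G=(V,E)$ and a function $\mathcal T:E\to 2^{\mathbb Z^+}\setminus\{\emptyset\}$ (finite sets); its time-edges are $\mathcal E(\mathcal G)=\{(e,t):e\in E,\ t\in\mathcal T(e)\}$ and its lifetime is $T(\mathcal G)=\max\{t:(e,t)\in\mathcal E(\mathcal G)\}$. An interval $[a,b]$ means $\{a,\dots,b\}\subseteq\mathbb Z$. An edge $e$ is $\Delta_1$-dense in $[a,b]$ if for every $\tau\in[a,\max\{a,b-\Delta_1+1\}]$ there is $t\in\mathcal T(e)$ with $\tau\le t\le\tau+\Delta_1-1$. A template is a pair $(X,[a,b])$ with $X$ a vertex set. Templates $(X,[a,b])$, $(Y,[c,d])$ are $\Delta_2$-independent if $X\cap Y=\emptyset$ or $|s-t|\ge\Delta_2$ for all $s\in[a,b]$, $t\in[c,d]$. $\mathcal G$ realises a collection $\{(X_i,[a_i,b_i])\}_i$ of pairwise $\Delta_2$-independent templates with $1\le a_i\le b_i\le T(\mathcal G)$ if every time-edge $(xy,t)$ has some $i$ with $x,y\in X_i$, $t\in[a_i,b_i]$, and for every $i$ and distinct $x,y\in X_i$, $xy$ is an edge that is $\Delta_1$-dense in $[a_i,b_i]$; $\mathcal G$ is a $(\Delta_1,\Delta_2)$-cluster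 temporal graph if it realises some such collection. For $S\subseteq V$, $\mathcal G[S]$ is the temporal graph on vertex set $S$ whose time-edges are those of $\mathcal G$ with both endpoints in $S$. -}

module Defs where

open import Data.Nat using (ℕ; zero; suc; _+_; _∸_; _≤_; _<_; _⊔_; ∣_-_∣)
open import Data.Bool using (Bool; true; false; T)
open import Data.Bool.Properties using (T-irrelevant)
open import Data.List using (List; []; _∷_; foldr; map; concatMap; length; lookup)
open import Data.List.Membership.Propositional using (_∈_)
open import Data.List.Relation.Unary.Any using (here; there)
open import Data.Fin using (Fin)
open import Data.Product using (Σ; _×_; _,_; proj₁; proj₂; ∃; ∃-syntax)
open import Data.Sum using (_⊎_)
open import Data.Empty using (⊥; ⊥-elim)
open import Data.Unit using (tt)
open import Relation.Nullary using (¬_)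
open import Relation.Binary.PropositionalEquality using (_≡_; _≢_; refl; cong; subst) renaming (sym to ≡-sym)

-- The static edge set is
-- E = { xy : time x y ≢ [] }, so 𝒯(e) is automatically non-empty for
-- every edge e.

record TemporalGraph : Set₁ where
  field
    V        : Set
    enum     : List V
    complete : (v : V) → v ∈ enum
    time     : V → V → List ℕ
    sym      : (x y : V) → time x y ≡ time y x
    loopless : (x : V) → time x x ≡ []
    positive : (x y : V) (t : ℕ) → t ∈ time x y → 1 ≤ t

open TemporalGraph public

IsEdge : (G : TemporalGraph) → V G → V G → Set
IsEdge G x y = time G x y ≢ []

TimeEdge : (G : TemporalGraph) → V G → V G → ℕ → Set
TimeEdge G x y t = t ∈ time G x y

maxList : List ℕ → ℕ
maxList = foldr _⊔_ 0

-- lifetime T(𝒢) = max { t : (e,t) ∈ ℰ(𝒢) }   (0 if there are no time-edges)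
lifetime : TemporalGraph → ℕ
lifetime G =
  maxList (concatMap (λ x → map (λ y → maxList (time G x y)) (enum G)) (enum G))

-- Since a ≥ 0, truncated
-- subtraction (b + 1) ∸ Δ₁ gives the same maximum as integer subtraction.

Dense : (G : TemporalGraph) → ℕ → V G → V G → ℕ → ℕ → Set
Dense G Δ₁ x y a b =
  (τ : ℕ) → a ≤ τ → τ ≤ a ⊔ ((b + 1) ∸ Δ₁) →
  ∃[ t ] (t ∈ time G x y × τ ≤ t × t < τ + Δ₁)

record Template (V : Set) : Set₁ where
  constructor template
  field
    X : V → Set
    a : ℕ
    b : ℕ

open Template public

Independent : {V : Set} → ℕ → Template V → Template V → Set
Independent Δ₂ P Q =
  ((v : _) → X P v → X Q v → ⊥)
  ⊎ ((s t : ℕ) → a P ≤ s → s ≤ b P → a Q ≤ t → t ≤ b Q → Δ₂ ≤ ∣ s - t ∣)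

Realises : (G : TemporalGraph) → ℕ → ℕ → List (Template (V G)) → Set
Realises G Δ₁ Δ₂ ts =
  ((i j : Fin (length ts)) → i ≢ j → Independent Δ₂ (lookup ts i) (lookup ts j))
  × ((i : Fin (length ts)) →
       1 ≤ a (lookup ts i) × a (lookup ts i) ≤ b (lookup ts i)
       × b (lookup ts i) ≤ lifetime G)
  × ((x y : V G) (t : ℕ) → TimeEdge G x y t →
       ∃[ i ] (X (lookup ts i) x × X (lookup ts i) y
               × a (lookup ts i) ≤ t × t ≤ b (lookup ts i)))
  × ((i : Fin (length ts)) (x y : V G) → X (lookup ts i) x → X (lookup ts i) y →
       x ≢ y →
       IsEdge G x y × Dense G Δ₁ x y (a (lookup ts i)) (b (lookup ts i)))

IsCluster : ℕ → ℕ → TemporalGraph → Set₁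
IsCluster Δ₁ Δ₂ G = Σ (List (Template (V G))) (Realises G Δ₁ Δ₂)

Sub : (G : TemporalGraph) → (V G → Bool) → Set
Sub G S = Σ (V G) (λ v → T (S v))

module _ {A : Set} (S : A → Bool) where

  private
    Sig : Set
    Sig = Σ A (λ v → T (S v))

  step : (v : A) (b : Bool) → S v ≡ b → List Sig → List Sig
  step v true  e r = (v , subst T (≡-sym e) tt) ∷ r
  step v false e r = r

  restrict : List A → List Sig
  restrict []       = []
  restrict (v ∷ vs) = step v (S v) refl (restrict vs)

  step-here : (v : A) (b : Bool) (e : S v ≡ b) (r : List Sig) (p : T (S v)) →
              (v , p) ∈ step v b e r
  step-here v true  e r p = here (cong (v ,_) (T-irrelevant p (subst T (≡-sym e) tt)))
  step-here v false e r p = ⊥-elim (subst T e p)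

  step-there : (v : A) (b : Bool) (e : S v ≡ b) (r : List Sig) {x : Sig} →
               x ∈ r → x ∈ step v b e r
  step-there v true  e r m = there m
  step-there v false e r m = m

  restrict-complete : (l : List A) (v : A) (p : T (S v)) → v ∈ l → (v , p) ∈ restrict l
  restrict-complete (w ∷ vs) v p (here refl) = step-here v (S v) refl (restrict vs) p
  restrict-complete (w ∷ vs) v p (there m)   =
    step-there w (S w) refl (restrict vs) (restrict-complete vs v p m)

induced : (G : TemporalGraph) → (V G → Bool) → TemporalGraph
induced G S = record
  { V        = Sub G S
  ; enum     = restrict S (enum G)
  ; complete = λ { (v , p) → restrict-complete S (enum G) v p (complete G v) }
  ; time     = λ x y → time G (proj₁ x) (proj₁ y)
  ; sym      = λ x y → sym G (proj₁ x) (proj₁ y)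
  ; loopless = λ x → loopless G (proj₁ x)
  ; positive = λ x y → positive G (proj₁ x) (proj₁ y)
  }

-- The templates of 𝒢 are cut down to 𝒢[S]: each vertex set is intersected with S and each
-- interval [a, b] is clipped to [a, b ⊓ L], where L is the lifetime of 𝒢[S]; a template
-- starting after L becomes the empty template on [1, 1].  Restricting vertex sets and
-- shrinking intervals cannot destroy Δ₂-independence, a clique stays a clique, density on
-- [a, b] implies density on every [a, b'] with b' ≤ b, and every time-edge of 𝒢[S] lies in
-- [1, L], so it is still covered.  If 𝒢[S] has no time-edges (L = 0) the empty collection
-- realises it.
module Submission where

open import Defs
open import Data.Nat using (ℕ; _≤_; _<_)
open import Data.Bool using (Bool)
open import Data.Nat using (_⊓_; _≤?_; _≟_; z≤n; s≤s)
open import Data.Nat.Properties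
  using ( ≤-trans; <⇒≱; m≤m⊔n; m≤n⊔m; m⊓n≤m; m⊓n≤n; ⊓-glb
        ; ⊔-monoʳ-≤; ∸-monoˡ-≤; +-monoˡ-≤; n≢0⇒n>0)
open import Data.Bool.Properties using (T-irrelevant)
open import Data.Fin as Fin using (Fin; zero; suc)
open import Data.Fin.Properties using (cast-involutive)
open import Data.List using (List; []; _∷_; map; length; lookup)
open import Data.List.Properties using (length-map)
open import Data.List.Membership.Propositional using (_∈_)
open import Data.List.Membership.Propositional.Properties using (∈-map⁺; ∈-concatMap⁺)
open import Data.List.Relation.Unary.Any as Any using (here; there)
open import Data.Product using (_×_; _,_; proj₁; map₂; ∃-syntax)
open import Data.Sum using (inj₁; inj₂)
open import Data.Empty using (⊥; ⊥-elim)
open import Function using (_∘_)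
open import Level using (Level)
open import Relation.Nullary using (¬_; yes; no)
open import Relation.Binary.PropositionalEquality
  using (_≡_; _≢_; refl; cong; subst; trans; module ≡-Reasoning) renaming (sym to ≡-sym)
open ≡-Reasoning

private
  variable
    ℓ ℓ′ : Level
    A B : Set ℓ
    U W : Set

lookup-map : (f : A → B) (xs : List A) (i : Fin (length (map f xs))) →
             lookup (map f xs) i ≡ f (lookup xs (Fin.cast (length-map f xs) i))
lookup-map f (x ∷ xs) zero    = refl
lookup-map f (x ∷ xs) (suc i) = lookup-map f xs i

module _ (f : A → B) (xs : List A) where

  private
    fromMap : Fin (length (map f xs)) → Fin (length xs)
    fromMap = Fin.cast (length-map f xs)

    toMap : Fin (length xs) → Fin (length (map f xs))
    toMap = Fin.cast (≡-sym (length-map f xs))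

    fromMap-toMap : (i : Fin (length xs)) → fromMap (toMap i) ≡ i
    fromMap-toMap = cast-involutive (length-map f xs) (≡-sym (length-map f xs))

    toMap-fromMap : (i : Fin (length (map f xs))) → toMap (fromMap i) ≡ i
    toMap-fromMap = cast-involutive (≡-sym (length-map f xs)) (length-map f xs)

    fromMap-injective : {i j : Fin (length (map f xs))} → fromMap i ≡ fromMap j → i ≡ j
    fromMap-injective {i} {j} eq = begin
      i                 ≡⟨ toMap-fromMap i ⟨
      toMap (fromMap i) ≡⟨ cong toMap eq ⟩
      toMap (fromMap j) ≡⟨ toMap-fromMap j ⟩
      j                 ∎

  ∀-lookup-map : {P : A → Set} {Q : B → Set} → (∀ {x} → P x → Q (f x)) →
                 (∀ i → P (lookup xs i)) → ∀ i → Q (lookup (map f xs) i)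
  ∀-lookup-map {Q = Q} f-pres all i =
    subst Q (≡-sym (lookup-map f xs i)) (f-pres (all (fromMap i)))

  ∃-lookup-map : {P : A → Set} {Q : B → Set} → (∀ {x} → P x → Q (f x)) →
                 ∃[ i ] P (lookup xs i) → ∃[ j ] Q (lookup (map f xs) j)
  ∃-lookup-map {Q = Q} f-pres (i , p) =
    toMap i , subst Q (≡-sym (lookup-map-toMap)) (f-pres p)
    where
      lookup-map-toMap : lookup (map f xs) (toMap i) ≡ f (lookup xs i)
      lookup-map-toMap = trans (lookup-map f xs (toMap i)) (cong (f ∘ lookup xs) (fromMap-toMap i))

  pairwise-lookup-map : {R : A → A → Set} {R′ : B → B → Set} →
                        (∀ {x y} → R x y → R′ (f x) (f y)) →
                        (∀ i j → i ≢ j → R (lookup xs i) (lookup xs j)) →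
                        ∀ i j → i ≢ j → R′ (lookup (map f xs) i) (lookup (map f xs) j)
  pairwise-lookup-map f-pres pairwise i j i≢j
    rewrite lookup-map f xs i | lookup-map f xs j =
    f-pres (pairwise (fromMap i) (fromMap j) (i≢j ∘ fromMap-injective))

≤-maxList : {t : ℕ} {ts : List ℕ} → t ∈ ts → t ≤ maxList ts
≤-maxList {ts = s ∷ ts} (here refl) = m≤m⊔n s (maxList ts)
≤-maxList {ts = s ∷ ts} (there t∈ts) = ≤-trans (≤-maxList t∈ts) (m≤n⊔m s (maxList ts))

≤-lifetime : (G : TemporalGraph) {x y : V G} {t : ℕ} → TimeEdge G x y t → t ≤ lifetime G
≤-lifetime G {x} {y} t∈xy =
  ≤-trans (≤-maxList t∈xy) (≤-maxList (∈-concatMap⁺ row (Any.map column (complete G x))))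
  where
    row : V G → List ℕ
    row u = map (λ v → maxList (time G u v)) (enum G)
    column : ∀ {u} → x ≡ u → maxList (time G x y) ∈ row u
    column refl = ∈-map⁺ (λ v → maxList (time G x v)) (complete G y)

Dense-shrink : (G : TemporalGraph) (Δ₁ : ℕ) {x y : V G} {a b b′ : ℕ} → b′ ≤ b →
               Dense G Δ₁ x y a b → Dense G Δ₁ x y a b′
Dense-shrink G Δ₁ {a = a} b′≤b dense τ a≤τ τ≤ =
  dense τ a≤τ (≤-trans τ≤ (⊔-monoʳ-≤ a (∸-monoˡ-≤ Δ₁ (+-monoˡ-≤ 1 b′≤b))))

Bounded : {V : Set} → ℕ → Template V → Set
Bounded L P = 1 ≤ a P × a P ≤ b P × b P ≤ L

Covers : {V : Set} → Template V → V → V → ℕ → Set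
Covers P x y t = X P x × X P y × a P ≤ t × t ≤ b P

DenseClique : (G : TemporalGraph) → ℕ → Template (V G) → Set
DenseClique G Δ₁ P = (x y : V G) → X P x → X P y → x ≢ y →
                     IsEdge G x y × Dense G Δ₁ x y (a P) (b P)

comap : (U → W) → Template W → Template U
comap f P = template (X P ∘ f) (a P) (b P)

Independent-comap : {Δ₂ : ℕ} (f : U → W) {P Q : Template W} →
                    Independent Δ₂ P Q → Independent Δ₂ (comap f P) (comap f Q)
Independent-comap f (inj₁ disjoint) = inj₁ (disjoint ∘ f)
Independent-comap f (inj₂ far)      = inj₂ far

truncate : ℕ → Template U → Template U
truncate L P with a P ≤? L
... | yes _ = template (X P) (a P) (b P ⊓ L)
... | no  _ = template (λ _ → ⊥) 1 1

module _ (L : ℕ) where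

  Independent-truncate : {Δ₂ : ℕ} {P Q : Template U} →
                         Independent Δ₂ P Q → Independent Δ₂ (truncate L P) (truncate L Q)
  Independent-truncate {P = P} {Q} independent with a P ≤? L | a Q ≤? L | independent
  ... | no _  | _     | _             = inj₁ λ _ ()
  ... | yes _ | no _  | _             = inj₁ λ _ _ ()
  ... | yes _ | yes _ | inj₁ disjoint = inj₁ disjoint
  ... | yes _ | yes _ | inj₂ far      =
    inj₂ λ s t a≤s s≤b a≤t t≤b →
      far s t a≤s (≤-trans s≤b (m⊓n≤m _ _)) a≤t (≤-trans t≤b (m⊓n≤m _ _))

  Bounded-truncate : 1 ≤ L → {M : ℕ} {P : Template U} → Bounded M P → Bounded L (truncate L P)
  Bounded-truncate 1≤L {P = P} (1≤a , a≤b , _) with a P ≤? L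
  ... | yes a≤L = 1≤a , ⊓-glb a≤b a≤L , m⊓n≤n _ _
  ... | no  _   = s≤s z≤n , s≤s z≤n , 1≤L

  Covers-truncate : {t : ℕ} → t ≤ L → {P : Template U} {x y : U} →
                    Covers P x y t → Covers (truncate L P) x y t
  Covers-truncate t≤L {P} (x∈P , y∈P , a≤t , t≤b) with a P ≤? L
  ... | yes _   = x∈P , y∈P , a≤t , ⊓-glb t≤b t≤L
  ... | no  a≰L = ⊥-elim (a≰L (≤-trans a≤t t≤L))

  DenseClique-truncate : (G : TemporalGraph) (Δ₁ : ℕ) {P : Template (V G)} →
                         DenseClique G Δ₁ P → DenseClique G Δ₁ (truncate L P)
  DenseClique-truncate G Δ₁ {P} clique x y x∈P y∈P x≢y with a P ≤? L
  ... | yes _ = map₂ (Dense-shrink G Δ₁ (m⊓n≤m (b P) L)) (clique x y x∈P y∈P x≢y)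
  ... | no  _ = ⊥-elim x∈P

module _ (G : TemporalGraph) (S : V G → Bool) where

  proj₁-injective : {x y : Sub G S} → proj₁ x ≡ proj₁ y → x ≡ y
  proj₁-injective {v , p} {.v , q} refl = cong (v ,_) (T-irrelevant p q)

  DenseClique-induced : (Δ₁ : ℕ) {P : Template (V G)} →
                        DenseClique G Δ₁ P → DenseClique (induced G S) Δ₁ (comap proj₁ P)
  DenseClique-induced Δ₁ clique x y x∈P y∈P x≢y =
    clique (proj₁ x) (proj₁ y) x∈P y∈P (x≢y ∘ proj₁-injective)

Realises-[] : (G : TemporalGraph) {Δ₁ Δ₂ : ℕ} → lifetime G ≡ 0 → Realises G Δ₁ Δ₂ []
Realises-[] G T≡0 = (λ ()) , (λ ()) , (λ x y t → ⊥-elim ∘ no-time-edge x y t) , λ ()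
  where
    no-time-edge : (x y : V G) (t : ℕ) → ¬ TimeEdge G x y t
    no-time-edge x y t t∈xy =
      <⇒≱ (positive G x y t t∈xy) (subst (t ≤_) T≡0 (≤-lifetime G t∈xy))

Realises-induced : {Δ₁ Δ₂ : ℕ} (G : TemporalGraph) (S : V G → Bool) {ts : List (Template (V G))} →
                   1 ≤ lifetime (induced G S) → Realises G Δ₁ Δ₂ ts →
                   Realises (induced G S) Δ₁ Δ₂ (map (comap proj₁ ∘ truncate (lifetime (induced G S))) ts)
Realises-induced {Δ₁} {Δ₂} G S {ts} 1≤L (independent , bounded , covered , cliques) =
  pairwise-lookup-map restrictTemplate ts {Independent Δ₂} {Independent Δ₂}
    (Independent-comap proj₁ ∘ Independent-truncate L) independent ,
  ∀-lookup-map restrictTemplate ts {Bounded (lifetime G)} {Bounded L}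
    (Bounded-truncate L 1≤L) bounded ,
  (λ x y t t∈xy → ∃-lookup-map restrictTemplate ts
    {λ P → Covers P (proj₁ x) (proj₁ y) t} {λ P → Covers P x y t}
    (Covers-truncate L (≤-lifetime (induced G S) {x} {y} t∈xy))
    (covered (proj₁ x) (proj₁ y) t t∈xy)) ,
  ∀-lookup-map restrictTemplate ts {DenseClique G Δ₁} {DenseClique (induced G S) Δ₁}
    (DenseClique-induced G S Δ₁ ∘ DenseClique-truncate L G Δ₁) cliques
  where
    L : ℕ
    L = lifetime (induced G S)
    restrictTemplate : Template (V G) → Template (Sub G S)
    restrictTemplate = comap proj₁ ∘ truncate L

lemma8 : (Δ₁ Δ₂ : ℕ) → 1 ≤ Δ₁ → Δ₁ < Δ₂ →
         (G : TemporalGraph) → IsCluster Δ₁ Δ₂ G →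
         (S : V G → Bool) → IsCluster Δ₁ Δ₂ (induced G S)
lemma8 Δ₁ Δ₂ _ _ G (ts , realises) S with lifetime (induced G S) ≟ 0
... | yes T≡0 = [] , Realises-[] (induced G S) T≡0
... | no  T≢0 = map (comap proj₁ ∘ truncate (lifetime (induced G S))) ts ,
                Realises-induced G S {ts} (n≢0⇒n>0 T≢0) realises
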